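{- Let $\lambda$ be a bicolored plane tree which is determined uniquely by its type, i.e. every bicolored plane tree of the same type as $\lambda$ is equivalent to $\lambda$. Then $\lambda$ is either a star with black center, or a star with white center, or the tree $\lambda_{r,s}$ for some integers $r,s\geq 1$.
   Context: A plane tree is a tree embedded in $\mathbb{C}$; it is bicolored if its vertices are colored white and black so every edge joins vertices of different colors. Two bicolored plane trees are equivalent if some orientation preserving, color preserving homeomorphism of $\mathbb{C}$ maps one onto the other. The type of $\lambda$ is the sequence of valencies of its white vertices in decreasing order. A star with black center is a tree with a single black vertex (all white vertices having valency $1$); a star with white center is a tree with a single white vertex (all black vertices having valency $1$). For integers $r,s\geq1$, $\lambda_{r,s}$ is the bicolored plane tree with exactly two white vertices, of valencies $r$ and $s$, joined through a common black vertex of valency $2$, all other black vertices having valency $1$ (so the white vertices carry $r-1$ and $s-1$ further pendant black vertices respectively). -}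

module Defs where

open import Data.Nat using (ℕ; zero; suc; _+_; _≤_)
open import Data.Bool using (Bool; true; false; not; _∨_)
open import Data.Fin using (Fin; toℕ; _≟_)
open import Data.Fin.Permutation using (Permutation′; _⟨$⟩ʳ_)
open import Data.List using (List; []; _∷_; filterᵇ; map; length; upTo; allFin)
open import Data.Bool.ListAction using (any; all)
open import Data.List.Relation.Binary.Permutation.Propositional using (_↭_)
open import Data.Product using (Σ; ∃; _×_; _,_)
open import Relation.Binary.PropositionalEquality using (_≡_)
open import Relation.Nullary using (¬_)
open import Relation.Nullary.Decidable using (⌊_⌋)
import Data.Nat as ℕ

-- Combinatorial model of bicolored plane trees (standard dessin/constellation
-- encoding): the n edges are labelled by Fin n; `white` (resp. `black`) is the
-- permutation of edges sending each edge to the next edge counterclockwise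
-- around its white (resp. black) endpoint.  Vertices of a colour = cycles of
-- the corresponding permutation; valency = cycle length.

module _ {n : ℕ} where

  iter : (Fin n → Fin n) → ℕ → Fin n → Fin n
  iter f zero    x = x
  iter f (suc k) x = f (iter f k x)

  sameOrbit : (Fin n → Fin n) → Fin n → Fin n → Bool
  sameOrbit f x y = any (λ k → ⌊ iter f k x ≟ y ⌋) (upTo n)

  isLeader : (Fin n → Fin n) → Fin n → Bool
  isLeader f x = all (λ y → not (sameOrbit f x y) ∨ ⌊ toℕ x ℕ.≤? toℕ y ⌋) (allFin n)

  cycleLen : (Fin n → Fin n) → Fin n → ℕ
  cycleLen f x = length (filterᵇ (sameOrbit f x) (allFin n))

  cycleType : (Fin n → Fin n) → List ℕ
  cycleType f = map (cycleLen f) (filterᵇ (isLeader f) (allFin n))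

  numCycles : (Fin n → Fin n) → ℕ
  numCycles f = length (cycleType f)

  data Reach (f g : Fin n → Fin n) (x : Fin n) : Fin n → Set where
    here : Reach f g x x
    viaf : ∀ {y} → Reach f g x y → Reach f g x (f y)
    viag : ∀ {y} → Reach f g x y → Reach f g x (g y)

-- A bicolored plane tree with n edges.  Connected + (#vertices = #edges + 1)
-- makes the underlying graph a tree; every rotation system on a tree is planar.
record BPT (n : ℕ) : Set where
  field
    white : Permutation′ n
    black : Permutation′ n
  w : Fin n → Fin n
  w x = white ⟨$⟩ʳ x
  b : Fin n → Fin n
  b x = black ⟨$⟩ʳ x
  field
    connected : ∀ x y → Reach w b x y
    euler     : numCycles w + numCycles b ≡ suc n

open BPT public

-- type: multiset of white valencies (compared up to reordering, which is the
-- same as comparing the decreasingly sorted sequences)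
type : ∀ {n} → BPT n → List ℕ
type λ₀ = cycleType (w λ₀)

SameType : ∀ {n} → BPT n → BPT n → Set
SameType μ λ₀ = type μ ↭ type λ₀

-- equivalence: a relabelling of edges conjugating both rotations
-- (= orientation- and colour-preserving homeomorphism of ℂ)
Equivalent : ∀ {n} → BPT n → BPT n → Set
Equivalent {n} μ λ₀ = Σ (Permutation′ n) λ p →
  (∀ x → p ⟨$⟩ʳ (w μ x) ≡ w λ₀ (p ⟨$⟩ʳ x)) ×
  (∀ x → p ⟨$⟩ʳ (b μ x) ≡ b λ₀ (p ⟨$⟩ʳ x))

DeterminedByType : ∀ {n} → BPT n → Set
DeterminedByType {n} λ₀ = (μ : BPT n) → SameType μ λ₀ → Equivalent μ λ₀

StarBlackCenter : ∀ {n} → BPT n → Set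
StarBlackCenter λ₀ = numCycles (b λ₀) ≡ 1

StarWhiteCenter : ∀ {n} → BPT n → Set
StarWhiteCenter λ₀ = numCycles (w λ₀) ≡ 1

-- λ₀ is (equivalent to) λ_{r,s}: exactly two white vertices, of valencies r
-- and s, joined through a common black vertex of valency 2 (the black vertex
-- of edge e, whose other edge is b e), all other black vertices of valency 1.
IsLambda : ∀ {n} → ℕ → ℕ → BPT n → Set
IsLambda {n} r s λ₀ =
  numCycles (w λ₀) ≡ 2 ×
  Σ (Fin n) λ e →
    sameOrbit (w λ₀) e (b λ₀ e) ≡ false ×
    cycleLen (w λ₀) e ≡ r ×
    cycleLen (w λ₀) (b λ₀ e) ≡ s ×
    cycleLen (b λ₀) e ≡ 2 ×
    (∀ x → sameOrbit (b λ₀) e x ≡ false → cycleLen (b λ₀) x ≡ 1)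

-- A cycle of length ℓ
-- contains ℓ − 1 non-leaders, so Euler's relation for trees reads
-- #cycles(w) = 1 + #non-leaders(b). Suppose b has several cycles and let k = #cycles(w);
-- k = 1 is the star with white centre. If k = 2, b has a single non-leader, so it is a
-- transposition, and connectivity forces it to join the two white vertices: this is
-- λ_{r,s}. If k ≥ 3, some white vertex has a second edge z. Keep w, pick the leading
-- edge of every white vertex, and build two trees of the same type: in one, b is a
-- single k-cycle through the chosen edges; in the other, b is a (k − 1)-cycle through
-- all of them but one, together with the transposition joining that one to z.
-- Equivalence preserves whether all edges moved by b lie in one b-cycle, which holds
-- only for the first tree, so the type does not determine the tree.

module Submission where

open import Defs
open import Data.Nat using (ℕ; _≤_)
open import Data.Product using (Σ; _×_)
open import Data.Sum using (_⊎_)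

open import Data.Bool using (Bool; true; false; not; _∧_; _∨_; T; T?; if_then_else_)
open import Data.Bool.Properties using (T-∧; T-∨; T-not-≡; ∧-comm; ∧-distribˡ-∨)
open import Data.Empty using (⊥; ⊥-elim)
open import Data.Fin as Fin using (Fin; zero; suc; toℕ; _≟_)
import Data.Fin.Induction as Finᵢ
open import Data.Fin.Permutation
  using (Permutation′; _⟨$⟩ʳ_; _⟨$⟩ˡ_; _∘ₚ_; permutation; flip; inverseˡ; inverseʳ)
import Data.Fin.Properties as Finₚ
open import Data.List using (length; filterᵇ; tabulate; allFin; upTo)
open import Data.List.Membership.Propositional using (lose)
open import Data.List.Membership.Propositional.Properties using (∈-upTo⁺; ∈-allFin)
open import Data.List.Properties using (length-map)
open import Data.List.Relation.Binary.Permutation.Propositional using (↭-refl)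
import Data.List.Relation.Unary.All as All
open import Data.List.Relation.Unary.All.Properties using (all⁺; all⁻; ¬All⇒Any¬)
open import Data.List.Relation.Unary.Any using (satisfied)
open import Data.List.Relation.Unary.Any.Properties using (any⁺; any⁻)
import Data.Nat as ℕ
open import Data.Nat using (zero; suc; _+_; _*_; _∸_; _<_; z≤n; s≤s)
open import Data.Nat.DivMod using (_%_; _/_; m≡m%n+[m/n]*n; m%n<n)
import Data.Nat.Properties as ℕₚ
open import Data.Product using (∃; _,_; proj₁; proj₂)
open import Data.Sum using (inj₁; inj₂)
import Data.Sum as Sum
open import Data.Vec.Functional using (_∷_; [])
open import Function using (_∘_; _⇔_; mk⇔; Equivalence; Injection)
open import Function.Definitions using (Injective)
open import Function.Properties.Inverse using (Inverse⇒Injection)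
open import Induction.WellFounded using (Acc; acc)
open import Relation.Binary.PropositionalEquality
  using (_≡_; _≢_; refl; sym; trans; cong; cong₂; subst; module ≡-Reasoning)
open import Relation.Nullary using (¬_; yes; no; contradiction)
open import Relation.Nullary.Decidable
  using (⌊_⌋; toWitness; fromWitness; fromWitnessFalse; isYes≗does; ⌊⌋-map′)

private
  variable
    m n : ℕ

T-not⇒¬T : {b : Bool} → T (not b) → ¬ T b
T-not⇒¬T {false} _ ()

¬T⇒T-not : {b : Bool} → ¬ T b → T (not b)
¬T⇒T-not {false} _  = _
¬T⇒T-not {true}  ¬b = ¬b _

T-ext : {a b : Bool} → (T a → T b) → (T b → T a) → a ≡ b
T-ext {false} {false} _   _   = refl
T-ext {false} {true}  _   b⇒a = ⊥-elim (b⇒a _)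
T-ext {true}  {false} a⇒b _   = ⊥-elim (a⇒b _)
T-ext {true}  {true}  _   _   = refl

-- Counting

count : (Fin n → Bool) → ℕ
count {zero}  P = 0
count {suc n} P = if P zero then suc (count (P ∘ suc)) else count (P ∘ suc)

length-filterᵇ-tabulate : (P : Fin n → Bool) (f : Fin m → Fin n) →
                          length (filterᵇ P (tabulate f)) ≡ count (P ∘ f)
length-filterᵇ-tabulate {m = zero}  P f = refl
length-filterᵇ-tabulate {m = suc m} P f with P (f zero)
... | true  = cong suc (length-filterᵇ-tabulate P (f ∘ suc))
... | false = length-filterᵇ-tabulate P (f ∘ suc)

length-filterᵇ-allFin : (P : Fin n → Bool) → length (filterᵇ P (allFin n)) ≡ count P
length-filterᵇ-allFin P = length-filterᵇ-tabulate P (λ i → i)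

count-cong : {P Q : Fin n → Bool} → (∀ i → P i ≡ Q i) → count P ≡ count Q
count-cong {zero}          P≡Q = refl
count-cong {suc n} {P} {Q} P≡Q with P zero | Q zero | P≡Q zero
... | true  | true  | _ = cong suc (count-cong (P≡Q ∘ suc))
... | false | false | _ = count-cong (P≡Q ∘ suc)

count-⇔ : {P Q : Fin n → Bool} → (∀ i → T (P i) → T (Q i)) → (∀ i → T (Q i) → T (P i)) →
          count P ≡ count Q
count-⇔ P⇒Q Q⇒P = count-cong (λ i → T-ext (P⇒Q i) (Q⇒P i))

count-true : count {n} (λ _ → true) ≡ n
count-true {zero}  = refl
count-true {suc n} = cong suc count-true

count-false : count {n} (λ _ → false) ≡ 0
count-false {zero}  = refl
count-false {suc n} = count-false {n}

count-split : (P Q : Fin n → Bool) →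
              count P ≡ count (λ i → P i ∧ Q i) + count (λ i → P i ∧ not (Q i))
count-split {zero}  P Q = refl
count-split {suc n} P Q with P zero | Q zero | count-split (P ∘ suc) (Q ∘ suc)
... | true  | true  | ih = cong suc ih
... | true  | false | ih = trans (cong suc ih) (sym (ℕₚ.+-suc _ _))
... | false | _     | ih = ih

count-complement : (P : Fin n → Bool) → count P + count (not ∘ P) ≡ n
count-complement P = trans (sym (count-split (λ _ → true) P)) count-true

count-none : {P : Fin n → Bool} → (∀ i → ¬ T (P i)) → count P ≡ 0
count-none {zero}      ¬P = refl
count-none {suc n} {P} ¬P with P zero | ¬P zero
... | true  | ¬P₀ = ⊥-elim (¬P₀ _)
... | false | _   = count-none (¬P ∘ suc)

count-pos : {P : Fin n → Bool} {i : Fin n} → T (P i) → 0 < count P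
count-pos {suc n} {P} {zero} Pi with P zero
... | true  = s≤s z≤n
... | false = ⊥-elim Pi
count-pos {suc n} {P} {suc i} Pi with P zero
... | true  = s≤s z≤n
... | false = count-pos {P = P ∘ suc} Pi

count-witness : {P : Fin n → Bool} → 0 < count P → ∃ λ i → T (P i)
count-witness {suc n} {P} pos with P zero in P₀
... | true  = zero , subst T (sym P₀) _
... | false = let i , Pi = count-witness {P = P ∘ suc} pos in suc i , Pi

count-singleton : (a : Fin n) → count (λ i → ⌊ a ≟ i ⌋) ≡ 1
count-singleton {suc n} zero = cong suc (count-false {n})
count-singleton (suc a) = trans (count-cong (λ i → ⌊⌋-map′ _ _ (a ≟ i))) (count-singleton a)

count-∨ : {P Q : Fin n → Bool} → (∀ i → ¬ (T (P i) × T (Q i))) →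
          count (λ i → P i ∨ Q i) ≡ count P + count Q
count-∨ {zero}          disjoint = refl
count-∨ {suc n} {P} {Q} disjoint with P zero | Q zero | disjoint zero | count-∨ (disjoint ∘ suc)
... | true  | true  | ¬both | _  = ⊥-elim (¬both (_ , _))
... | true  | false | _     | ih = cong suc ih
... | false | true  | _     | ih = trans (cong suc ih) (sym (ℕₚ.+-suc _ _))
... | false | false | _     | ih = ih

count≡1⇒unique : {P : Fin n → Bool} {a b : Fin n} → count P ≡ 1 → T (P a) → T (P b) → a ≡ b
count≡1⇒unique {P = P} {a} {b} count≡1 Pa Pb with a ≟ b
... | yes a≡b = a≡b
... | no  a≢b = contradiction (subst (2 ≤_) count≡1 two≤count) ℕₚ.1+n≰n
  where
  two≤count : 2 ≤ count P
  two≤count = subst (2 ≤_) (sym (count-split P (λ i → ⌊ a ≟ i ⌋)))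
    (ℕₚ.+-mono-≤ (count-pos {i = a} (Equivalence.from T-∧ (Pa , fromWitness refl)))
                 (count-pos {i = b} (Equivalence.from T-∧ (Pb , fromWitnessFalse a≢b))))

inImage : (Fin m → Fin n) → Fin n → Bool
inImage M y = ⌊ Finₚ.any? (λ i → M i ≟ y) ⌋

inImage⁺ : (M : Fin m → Fin n) (i : Fin m) → T (inImage M (M i))
inImage⁺ M i = fromWitness (i , refl)

inImage⁻ : (M : Fin m → Fin n) (y : Fin n) → T (inImage M y) → ∃ λ i → M i ≡ y
inImage⁻ M y = toWitness

-- Not definitional: ⌊_⌋ = isYes only computes once the `does` field is a constructor.
inImage-suc : (M : Fin (suc m) → Fin n) (y : Fin n) →
              inImage M y ≡ ⌊ M zero ≟ y ⌋ ∨ inImage (M ∘ suc) y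
inImage-suc M y = trans (⌊⌋-map′ _ _ _) (trans (isYes≗does _)
  (sym (cong₂ _∨_ (isYes≗does (M zero ≟ y)) (isYes≗does (Finₚ.any? (λ i → M (suc i) ≟ y))))))

count-inImage : (M : Fin m → Fin n) → Injective _≡_ _≡_ M → count (inImage M) ≡ m
count-inImage {zero}  {n} M M-injective = count-false {n}
count-inImage {suc m}     M M-injective = begin
  count (inImage M)                                         ≡⟨ count-cong (inImage-suc M) ⟩
  count (λ y → ⌊ M zero ≟ y ⌋ ∨ inImage (M ∘ suc) y)       ≡⟨ count-∨ disjoint ⟩
  count (λ y → ⌊ M zero ≟ y ⌋) + count (inImage (M ∘ suc)) ≡⟨ cong₂ _+_ (count-singleton (M zero))
                                                                count-inImage-rest ⟩
  suc m                                                     ∎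
  where
  open ≡-Reasoning
  count-inImage-rest : count (inImage (M ∘ suc)) ≡ m
  count-inImage-rest = count-inImage (M ∘ suc) (Finₚ.suc-injective ∘ M-injective)
  disjoint : ∀ y → ¬ (T ⌊ M zero ≟ y ⌋ × T (inImage (M ∘ suc) y))
  disjoint y (M₀≡y , y∈rest) =
    let i , Mi≡y = inImage⁻ (M ∘ suc) y y∈rest
    in contradiction (M-injective (trans (toWitness M₀≡y) (sym Mi≡y))) (λ ())

record Enumeration (P : Fin n → Bool) (m : ℕ) : Set where
  field
    elem      : Fin m → Fin n
    injective : Injective _≡_ _≡_ elem
    sound     : ∀ i → T (P (elem i))
    complete  : ∀ x → T (P x) → ∃ λ i → elem i ≡ x

enumerate : (P : Fin n → Bool) → Enumeration P (count P)
enumerate {zero}  P = record { elem = λ () ; injective = λ {} ; sound = λ () ; complete = λ () }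
enumerate {suc n} P with P zero in P₀ | enumerate (P ∘ suc)
... | true  | E = record { elem = elem′ ; injective = injective′ ; sound = sound′ ; complete = complete′ }
  where
  module E = Enumeration E
  elem′ : Fin (suc (count (P ∘ suc))) → Fin (suc n)
  elem′ = zero ∷ suc ∘ E.elem
  injective′ : Injective _≡_ _≡_ elem′
  injective′ {zero}  {zero}  _ = refl
  injective′ {suc i} {suc j} e = cong suc (E.injective (Finₚ.suc-injective e))
  sound′ : ∀ i → T (P (elem′ i))
  sound′ zero    = subst T (sym P₀) _
  sound′ (suc i) = E.sound i
  complete′ : ∀ x → T (P x) → ∃ λ i → elem′ i ≡ x
  complete′ zero    _  = zero , refl
  complete′ (suc x) Px = let i , e = E.complete x Px in suc i , cong suc e
... | false | E = record
  { elem      = suc ∘ E.elem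
  ; injective = E.injective ∘ Finₚ.suc-injective
  ; sound     = E.sound
  ; complete  = complete′
  }
  where
  module E = Enumeration E
  complete′ : ∀ x → T (P x) → ∃ λ i → suc (E.elem i) ≡ x
  complete′ zero    P₀′ = ⊥-elim (subst T P₀ P₀′)
  complete′ (suc x) Px  = let i , e = E.complete x Px in i , cong suc e

-- Orbits and leaders

numCycles≡count : (f : Fin n → Fin n) → numCycles f ≡ count (isLeader f)
numCycles≡count {n} f =
  trans (length-map (cycleLen f) (filterᵇ (isLeader f) (allFin n))) (length-filterᵇ-allFin (isLeader f))

cycleLen≡count : (f : Fin n → Fin n) (x : Fin n) → cycleLen f x ≡ count (sameOrbit f x)
cycleLen≡count f x = length-filterᵇ-allFin (sameOrbit f x)

numCycles+nonLeaders : (f : Fin n → Fin n) → numCycles f + count (not ∘ isLeader f) ≡ n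
numCycles+nonLeaders f =
  trans (cong (_+ count (not ∘ isLeader f)) (numCycles≡count f)) (count-complement (isLeader f))

euler⇔ : (f g : Fin n → Fin n) →
         (numCycles f + numCycles g ≡ suc n) ⇔ (numCycles f ≡ suc (count (not ∘ isLeader g)))
euler⇔ {n} f g = mk⇔ (λ e → ℕₚ.+-cancelʳ-≡ (numCycles g) _ _ (trans e (sym total)))
                     (λ e → trans (cong (_+ numCycles g) e) total)
  where
  open ≡-Reasoning
  c = count (not ∘ isLeader g)
  total : suc c + numCycles g ≡ suc n
  total = begin
    suc (c + numCycles g) ≡⟨ cong suc (ℕₚ.+-comm c (numCycles g)) ⟩
    suc (numCycles g + c) ≡⟨ cong suc (numCycles+nonLeaders g) ⟩
    suc n                 ∎

SameOrbit : (Fin n → Fin n) → Fin n → Fin n → Set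
SameOrbit f x y = ∃ λ k → iter f k x ≡ y

module _ {f : Fin n → Fin n} where

  iter-+ : ∀ i j x → iter f (i + j) x ≡ iter f i (iter f j x)
  iter-+ zero    j x = refl
  iter-+ (suc i) j x = cong f (iter-+ i j x)

  iter-periodic : ∀ {p x} → iter f p x ≡ x → ∀ q → iter f (q * p) x ≡ x
  iter-periodic           fᵖx≡x zero    = refl
  iter-periodic {p} {x} fᵖx≡x (suc q) = begin
    iter f (p + q * p) x        ≡⟨ iter-+ p (q * p) x ⟩
    iter f p (iter f (q * p) x) ≡⟨ cong (iter f p) (iter-periodic fᵖx≡x q) ⟩
    iter f p x                  ≡⟨ fᵖx≡x ⟩
    x                           ∎
    where open ≡-Reasoning

  SameOrbit-refl : {x : Fin n} → SameOrbit f x x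
  SameOrbit-refl = 0 , refl

  SameOrbit-step : {x y : Fin n} → SameOrbit f x y → SameOrbit f x (f y)
  SameOrbit-step (k , fᵏx≡y) = suc k , cong f fᵏx≡y

  SameOrbit-trans : {x y z : Fin n} → SameOrbit f x y → SameOrbit f y z → SameOrbit f x z
  SameOrbit-trans (i , refl) (j , refl) = j + i , iter-+ j i _

  SameOrbit-closed : (S : Fin n → Set) → (∀ {x} → S x → S (f x)) →
                     {x y : Fin n} → S x → SameOrbit f x y → S y
  SameOrbit-closed S closed Sx (zero  , refl) = Sx
  SameOrbit-closed S closed Sx (suc k , refl) = closed (SameOrbit-closed S closed Sx (k , refl))

  fixed-SameOrbit : {x y : Fin n} → f x ≡ x → SameOrbit f x y → y ≡ x
  fixed-SameOrbit fx≡x = SameOrbit-closed (_≡ _) (λ { refl → fx≡x }) refl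

  sameOrbit-sound : {x y : Fin n} → T (sameOrbit f x y) → SameOrbit f x y
  sameOrbit-sound t = let k , fᵏx≟y = satisfied (any⁻ _ (upTo n) t) in k , toWitness fᵏx≟y

iter-conj : {f g p : Fin n → Fin n} → (∀ x → p (f x) ≡ g (p x)) →
            ∀ k x → p (iter f k x) ≡ iter g k (p x)
iter-conj           conj zero    x = refl
iter-conj {g = g} conj (suc k) x = trans (conj _) (cong g (iter-conj conj k x))

⟨$⟩ʳ-injective : (π : Permutation′ n) → Injective _≡_ _≡_ (π ⟨$⟩ʳ_)
⟨$⟩ʳ-injective π = Injection.injective (Inverse⇒Injection π)

module Orbits {f : Fin n → Fin n} (f-injective : Injective _≡_ _≡_ f) where

  iter-injective : ∀ k {x y} → iter f k x ≡ iter f k y → x ≡ y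
  iter-injective zero    eq = eq
  iter-injective (suc k) eq = iter-injective k (f-injective eq)

  period : ∀ x → ∃ λ p → 0 < p × p ≤ n × iter f p x ≡ x
  period x with Finₚ.pigeonhole (ℕₚ.n<1+n n) (λ (t : Fin (suc n)) → iter f (toℕ t) x)
  ... | i , j , i<j , fⁱx≡fʲx =
    toℕ j ∸ toℕ i , ℕₚ.m<n⇒0<n∸m i<j , p≤n , iter-injective (toℕ i) fⁱfᵖx≡fⁱx
    where
    open ≡-Reasoning
    p≤n : toℕ j ∸ toℕ i ≤ n
    p≤n = ℕₚ.≤-trans (ℕₚ.m∸n≤m (toℕ j) (toℕ i)) (ℕₚ.≤-pred (Finₚ.toℕ<n j))
    fⁱfᵖx≡fⁱx : iter f (toℕ i) (iter f (toℕ j ∸ toℕ i) x) ≡ iter f (toℕ i) x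
    fⁱfᵖx≡fⁱx = begin
      iter f (toℕ i) (iter f (toℕ j ∸ toℕ i) x) ≡⟨ iter-+ (toℕ i) _ x ⟨
      iter f (toℕ i + (toℕ j ∸ toℕ i)) x        ≡⟨ cong (λ t → iter f t x) (ℕₚ.m+[n∸m]≡n (ℕₚ.<⇒≤ i<j)) ⟩
      iter f (toℕ j) x                          ≡⟨ fⁱx≡fʲx ⟨
      iter f (toℕ i) x                          ∎

  SameOrbit-bounded : {x y : Fin n} → SameOrbit f x y → ∃ λ k → k < n × iter f k x ≡ y
  SameOrbit-bounded {x} (k , refl) with period x
  ... | p@(suc _) , _ , p≤n , fᵖx≡x = k % p , ℕₚ.<-≤-trans (m%n<n k p) p≤n , sym fᵏx≡fᵏ⁻x
    where
    open ≡-Reasoning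
    fᵏx≡fᵏ⁻x : iter f k x ≡ iter f (k % p) x
    fᵏx≡fᵏ⁻x = begin
      iter f k x                            ≡⟨ cong (λ t → iter f t x) (m≡m%n+[m/n]*n k p) ⟩
      iter f (k % p + k / p * p) x          ≡⟨ iter-+ (k % p) _ x ⟩
      iter f (k % p) (iter f (k / p * p) x) ≡⟨ cong (iter f (k % p)) (iter-periodic fᵖx≡x (k / p)) ⟩
      iter f (k % p) x                      ∎

  SameOrbit-sym : {x y : Fin n} → SameOrbit f x y → SameOrbit f y x
  SameOrbit-sym {x} (k , refl) with period x
  ... | suc p , _ , _ , fᵖx≡x = p * k , (begin
    iter f (p * k) (iter f k x) ≡⟨ iter-+ (p * k) k x ⟨
    iter f (p * k + k) x        ≡⟨ cong (λ t → iter f t x) pk+k≡k*[1+p] ⟩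
    iter f (k * suc p) x        ≡⟨ iter-periodic fᵖx≡x k ⟩
    x                           ∎)
    where
    open ≡-Reasoning
    pk+k≡k*[1+p] : p * k + k ≡ k * suc p
    pk+k≡k*[1+p] = trans (ℕₚ.+-comm (p * k) k) (ℕₚ.*-comm (suc p) k)

  sameOrbit-complete : {x y : Fin n} → SameOrbit f x y → T (sameOrbit f x y)
  sameOrbit-complete x∼y =
    let k , k<n , fᵏx≡y = SameOrbit-bounded x∼y
    in any⁺ _ (lose (∈-upTo⁺ k<n) (fromWitness fᵏx≡y))

  isLeader-minimal : {x y : Fin n} → T (isLeader f x) → SameOrbit f x y → toℕ x ≤ toℕ y
  isLeader-minimal {x} {y} Lx x∼y =
    toWitness (implied (All.lookup (all⁺ _ (allFin n) Lx) (∈-allFin y)) (sameOrbit-complete x∼y))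
    where
    implied : {a b : Bool} → T (not a ∨ b) → T a → T b
    implied {true} b _ = b

  ¬isLeader⇒smaller : {x : Fin n} → ¬ T (isLeader f x) → ∃ λ y → SameOrbit f x y × toℕ y < toℕ x
  ¬isLeader⇒smaller {x} ¬Lx =
    let y , violated = satisfied (¬All⇒Any¬ (T? ∘ _) (allFin n) (¬Lx ∘ all⁻ _))
        x∼y , x≰y    = refuted violated
    in y , sameOrbit-sound x∼y , ℕₚ.≰⇒> (x≰y ∘ fromWitness)
    where
    refuted : {a b : Bool} → ¬ T (not a ∨ b) → T a × ¬ T b
    refuted {false} ¬ok = contradiction _ ¬ok
    refuted {true}  ¬ok = _ , ¬ok

  isLeader-unique : {x y : Fin n} → T (isLeader f x) → T (isLeader f y) → SameOrbit f x y → x ≡ y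
  isLeader-unique Lx Ly x∼y =
    Finₚ.toℕ-injective (ℕₚ.≤-antisym (isLeader-minimal Lx x∼y) (isLeader-minimal Ly (SameOrbit-sym x∼y)))

  leaderOf : (x : Fin n) → ∃ λ ℓ → SameOrbit f x ℓ × T (isLeader f ℓ)
  leaderOf x = descend x (Finᵢ.<-wellFounded x)
    where
    descend : ∀ x → Acc Fin._<_ x → ∃ λ ℓ → SameOrbit f x ℓ × T (isLeader f ℓ)
    descend x (acc smaller) with T? (isLeader f x)
    ... | yes Lx  = x , SameOrbit-refl , Lx
    ... | no  ¬Lx =
      let y , x∼y , y<x = ¬isLeader⇒smaller ¬Lx
          ℓ , y∼ℓ , Lℓ  = descend y (smaller y<x)
      in ℓ , SameOrbit-trans x∼y y∼ℓ , Lℓ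

  fixed⇒isLeader : {x : Fin n} → f x ≡ x → T (isLeader f x)
  fixed⇒isLeader {x} fx≡x with T? (isLeader f x)
  ... | yes Lx  = Lx
  ... | no  ¬Lx =
    let y , x∼y , y<x = ¬isLeader⇒smaller ¬Lx
    in contradiction (subst (λ y → toℕ y < toℕ x) (fixed-SameOrbit fx≡x x∼y) y<x) (ℕₚ.<-irrefl refl)

  count-leaders-in-orbit : (a : Fin n) → count (λ y → sameOrbit f a y ∧ isLeader f y) ≡ 1
  count-leaders-in-orbit a = trans (count-⇔ is-ℓ is-leader) (count-singleton ℓ)
    where
    ℓ   = proj₁ (leaderOf a)
    a∼ℓ = proj₁ (proj₂ (leaderOf a))
    Lℓ  = proj₂ (proj₂ (leaderOf a))
    is-ℓ : ∀ y → T (sameOrbit f a y ∧ isLeader f y) → T ⌊ ℓ ≟ y ⌋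
    is-ℓ y t =
      let a∼y , Ly = Equivalence.to T-∧ t
      in fromWitness (isLeader-unique Lℓ Ly (SameOrbit-trans (SameOrbit-sym a∼ℓ) (sameOrbit-sound a∼y)))
    is-leader : ∀ y → T ⌊ ℓ ≟ y ⌋ → T (sameOrbit f a y ∧ isLeader f y)
    is-leader y t with toWitness t
    ... | refl = Equivalence.from T-∧ (sameOrbit-complete a∼ℓ , Lℓ)

  cycleLen≡suc-nonLeaders : (a : Fin n) →
                            cycleLen f a ≡ suc (count (λ x → not (isLeader f x) ∧ sameOrbit f a x))
  cycleLen≡suc-nonLeaders a = begin
    cycleLen f a
      ≡⟨ cycleLen≡count f a ⟩
    count (sameOrbit f a)
      ≡⟨ count-split (sameOrbit f a) (isLeader f) ⟩
    count (λ x → sameOrbit f a x ∧ isLeader f x) + count (λ x → sameOrbit f a x ∧ not (isLeader f x))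
      ≡⟨ cong₂ _+_ (count-leaders-in-orbit a) (count-cong (λ x → ∧-comm (sameOrbit f a x) _)) ⟩
    suc (count (λ x → not (isLeader f x) ∧ sameOrbit f a x))
      ∎
    where open ≡-Reasoning

  nonLeaders-within : (R : Fin n → Bool) → (∀ x → ¬ T (R x) → f x ≡ x) →
                      count (not ∘ isLeader f) ≡ count (λ x → not (isLeader f x) ∧ R x)
  nonLeaders-within R fixed-outside = begin
    count (not ∘ isLeader f)
      ≡⟨ count-split (not ∘ isLeader f) R ⟩
    count (λ x → not (isLeader f x) ∧ R x) + count (λ x → not (isLeader f x) ∧ not (R x))
      ≡⟨ cong (count (λ x → not (isLeader f x) ∧ R x) +_) (count-none leader-outside) ⟩
    count (λ x → not (isLeader f x) ∧ R x) + 0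
      ≡⟨ ℕₚ.+-identityʳ _ ⟩
    count (λ x → not (isLeader f x) ∧ R x)
      ∎
    where
    open ≡-Reasoning
    leader-outside : ∀ x → ¬ T (not (isLeader f x) ∧ not (R x))
    leader-outside x t =
      let ¬L , ¬R = Equivalence.to T-∧ t
      in T-not⇒¬T ¬L (fixed⇒isLeader (fixed-outside x (T-not⇒¬T ¬R)))

  numCycles-transitive : (a : Fin n) → (∀ y → SameOrbit f a y) → numCycles f ≡ 1
  numCycles-transitive a a∼ = begin
    numCycles f                                  ≡⟨ numCycles≡count f ⟩
    count (isLeader f)                           ≡⟨ count-⇔ in-orbit (λ y → proj₂ ∘ Equivalence.to T-∧) ⟩
    count (λ y → sameOrbit f a y ∧ isLeader f y) ≡⟨ count-leaders-in-orbit a ⟩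
    1                                            ∎
    where
    open ≡-Reasoning
    in-orbit : ∀ y → T (isLeader f y) → T (sameOrbit f a y ∧ isLeader f y)
    in-orbit y Ly = Equivalence.from T-∧ (sameOrbit-complete (a∼ y) , Ly)

  1≤cycleLen : (x : Fin n) → 1 ≤ cycleLen f x
  1≤cycleLen x = subst (1 ≤_) (sym (cycleLen≡count f x)) (count-pos {i = x} (sameOrbit-complete SameOrbit-refl))

  cycleLen-fixed : {x : Fin n} → f x ≡ x → cycleLen f x ≡ 1
  cycleLen-fixed {x} fx≡x = trans (cycleLen≡count f x) (trans (count-⇔ is-x in-orbit) (count-singleton x))
    where
    is-x : ∀ y → T (sameOrbit f x y) → T ⌊ x ≟ y ⌋
    is-x y t = fromWitness (sym (fixed-SameOrbit fx≡x (sameOrbit-sound t)))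
    in-orbit : ∀ y → T ⌊ x ≟ y ⌋ → T (sameOrbit f x y)
    in-orbit y t with toWitness t
    ... | refl = sameOrbit-complete SameOrbit-refl

record IsTransposition (f : Fin n → Fin n) (a b : Fin n) : Set where
  field
    distinct : a ≢ b
    maps-a   : f a ≡ b
    maps-b   : f b ≡ a
    fixes    : ∀ x → x ≢ a → x ≢ b → f x ≡ x

module _ {f : Fin n → Fin n} (f-injective : Injective _≡_ _≡_ f) where

  open Orbits f-injective

  module _ {a b : Fin n} (τ : IsTransposition f a b) where

    open IsTransposition τ

    SameOrbit-transposition : {y : Fin n} → SameOrbit f a y → y ≡ a ⊎ y ≡ b
    SameOrbit-transposition = SameOrbit-closed (λ y → y ≡ a ⊎ y ≡ b) step (inj₁ refl)
      where
      step : {y : Fin n} → y ≡ a ⊎ y ≡ b → f y ≡ a ⊎ f y ≡ b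
      step (inj₁ refl) = inj₂ maps-a
      step (inj₂ refl) = inj₁ maps-b

    cycleLen-transposition : cycleLen f a ≡ 2
    cycleLen-transposition = begin
      cycleLen f a                                       ≡⟨ cycleLen≡count f a ⟩
      count (sameOrbit f a)                              ≡⟨ count-⇔ a-or-b in-orbit ⟩
      count (λ y → ⌊ a ≟ y ⌋ ∨ ⌊ b ≟ y ⌋)                ≡⟨ count-∨ a-and-b ⟩
      count (λ y → ⌊ a ≟ y ⌋) + count (λ y → ⌊ b ≟ y ⌋) ≡⟨ cong₂ _+_ (count-singleton a) (count-singleton b) ⟩
      2                                                  ∎
      where
      open ≡-Reasoning
      a-or-b : ∀ y → T (sameOrbit f a y) → T (⌊ a ≟ y ⌋ ∨ ⌊ b ≟ y ⌋)
      a-or-b y t = Equivalence.from (T-∨ {⌊ a ≟ y ⌋})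
        (Sum.map (fromWitness {a? = a ≟ y} ∘ sym) (fromWitness {a? = b ≟ y} ∘ sym)
                 (SameOrbit-transposition (sameOrbit-sound t)))
      in-orbit : ∀ y → T (⌊ a ≟ y ⌋ ∨ ⌊ b ≟ y ⌋) → T (sameOrbit f a y)
      in-orbit y t with Equivalence.to (T-∨ {⌊ a ≟ y ⌋}) t
      ... | inj₁ a≡y = subst (T ∘ sameOrbit f a) (toWitness {a? = a ≟ y} a≡y)
                             (sameOrbit-complete SameOrbit-refl)
      ... | inj₂ b≡y = subst (T ∘ sameOrbit f a) (toWitness {a? = b ≟ y} b≡y)
                             (sameOrbit-complete (1 , maps-a))
      a-and-b : ∀ y → ¬ (T ⌊ a ≟ y ⌋ × T ⌊ b ≟ y ⌋)
      a-and-b y (a≡y , b≡y) =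
        distinct (trans (toWitness {a? = a ≟ y} a≡y) (sym (toWitness {a? = b ≟ y} b≡y)))

    cycleLen-off-transposition : {x : Fin n} → ¬ T (sameOrbit f a x) → cycleLen f x ≡ 1
    cycleLen-off-transposition {x} x∉ = cycleLen-fixed (fixes x x≢a x≢b)
      where
      x≢a : x ≢ a
      x≢a refl = x∉ (sameOrbit-complete SameOrbit-refl)
      x≢b : x ≢ b
      x≢b refl = x∉ (sameOrbit-complete (1 , maps-a))

  oneNonLeader⇒transposition : count (not ∘ isLeader f) ≡ 1 → ∃ λ a → ∃ λ b → IsTransposition f a b
  oneNonLeader⇒transposition one with count-witness (subst (0 <_) (sym one) (s≤s z≤n))
  ... | x₀ , ¬Lx₀ with leaderOf x₀
  ... | e , x₀∼e , Le =
    e , x₀ , record { distinct = e≢x₀ ; maps-a = fe≡x₀ ; maps-b = fx₀≡e ; fixes = fixes }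
    where
    leader-unless-x₀ : {x : Fin n} → x ≢ x₀ → T (isLeader f x)
    leader-unless-x₀ {x} x≢x₀ with T? (isLeader f x)
    ... | yes Lx  = Lx
    ... | no  ¬Lx = contradiction (count≡1⇒unique one (¬T⇒T-not ¬Lx) ¬Lx₀) x≢x₀
    e≢x₀ : e ≢ x₀
    e≢x₀ refl = T-not⇒¬T ¬Lx₀ Le
    fixed-between-leaders : {x : Fin n} → T (isLeader f x) → T (isLeader f (f x)) → f x ≡ x
    fixed-between-leaders Lx Lfx = sym (isLeader-unique Lx Lfx (1 , refl))
    fx₀≡e : f x₀ ≡ e
    fx₀≡e with f x₀ ≟ x₀
    ... | yes fx₀≡x₀ = contradiction (fixed⇒isLeader fx₀≡x₀) (T-not⇒¬T ¬Lx₀)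
    ... | no  fx₀≢x₀ = isLeader-unique (leader-unless-x₀ fx₀≢x₀) Le
                                       (SameOrbit-trans (SameOrbit-sym (1 , refl)) x₀∼e)
    fe≡x₀ : f e ≡ x₀
    fe≡x₀ with f e ≟ x₀
    ... | yes fe≡x₀ = fe≡x₀
    ... | no  fe≢x₀ = contradiction
      (fixed-SameOrbit (fixed-between-leaders Le (leader-unless-x₀ fe≢x₀)) (SameOrbit-sym x₀∼e))
      (e≢x₀ ∘ sym)
    fixes : ∀ x → x ≢ e → x ≢ x₀ → f x ≡ x
    fixes x x≢e x≢x₀ = fixed-between-leaders (leader-unless-x₀ x≢x₀)
      (leader-unless-x₀ (λ fx≡x₀ → x≢e (f-injective (trans fx≡x₀ (sym fe≡x₀)))))

-- Trees

module _ {f g : Fin n → Fin n} where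

  Reach-trans : {x y z : Fin n} → Reach f g x y → Reach f g y z → Reach f g x z
  Reach-trans r here     = r
  Reach-trans r (viaf s) = viaf (Reach-trans r s)
  Reach-trans r (viag s) = viag (Reach-trans r s)

  SameOrbit⇒Reachᶠ : {x y : Fin n} → SameOrbit f x y → Reach f g x y
  SameOrbit⇒Reachᶠ (zero  , refl) = here
  SameOrbit⇒Reachᶠ (suc k , refl) = viaf (SameOrbit⇒Reachᶠ (k , refl))

  SameOrbit⇒Reachᵍ : {x y : Fin n} → SameOrbit g x y → Reach f g x y
  SameOrbit⇒Reachᵍ (zero  , refl) = here
  SameOrbit⇒Reachᵍ (suc k , refl) = viag (SameOrbit⇒Reachᵍ (k , refl))

  Reach-closed : (S : Fin n → Set) → (∀ {x} → S x → S (f x)) → (∀ {x} → S x → S (g x)) →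
                 {x y : Fin n} → S x → Reach f g x y → S y
  Reach-closed S f-closed g-closed Sx here     = Sx
  Reach-closed S f-closed g-closed Sx (viaf r) = f-closed (Reach-closed S f-closed g-closed Sx r)
  Reach-closed S f-closed g-closed Sx (viag r) = g-closed (Reach-closed S f-closed g-closed Sx r)

  module _ (f-injective : Injective _≡_ _≡_ f) (g-injective : Injective _≡_ _≡_ g) where

    Reach-sym : {x y : Fin n} → Reach f g x y → Reach f g y x
    Reach-sym here     = here
    Reach-sym (viaf r) = Reach-trans (SameOrbit⇒Reachᶠ (Orbits.SameOrbit-sym f-injective (1 , refl))) (Reach-sym r)
    Reach-sym (viag r) = Reach-trans (SameOrbit⇒Reachᵍ (Orbits.SameOrbit-sym g-injective (1 , refl))) (Reach-sym r)

    connected-via : (hub : Fin n) → (∀ x → Reach f g x hub) → ∀ x y → Reach f g x y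
    connected-via hub to-hub x y = Reach-trans (to-hub x) (Reach-sym (to-hub y))

module _ (λ₀ : BPT n) where

  w-injective : Injective _≡_ _≡_ (w λ₀)
  w-injective = ⟨$⟩ʳ-injective (white λ₀)

  b-injective : Injective _≡_ _≡_ (b λ₀)
  b-injective = ⟨$⟩ʳ-injective (black λ₀)

  numCycles-white : numCycles (w λ₀) ≡ suc (count (not ∘ isLeader (b λ₀)))
  numCycles-white = Equivalence.to (euler⇔ (w λ₀) (b λ₀)) (euler λ₀)

  numCycles-black : numCycles (b λ₀) ≡ suc (count (not ∘ isLeader (w λ₀)))
  numCycles-black = Equivalence.to (euler⇔ (b λ₀) (w λ₀))
    (trans (ℕₚ.+-comm (numCycles (b λ₀)) (numCycles (w λ₀))) (euler λ₀))

  white-nonLeader : numCycles (b λ₀) ≢ 1 → ∃ λ z → ¬ T (isLeader (w λ₀) z)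
  white-nonLeader many-black =
    let z , t = count-witness (ℕₚ.n≢0⇒n>0 (many-black ∘ trans numCycles-black ∘ cong suc))
    in z , T-not⇒¬T t

  b-closed-orbit⇒numCycles-white≡1 : (a : Fin n) →
                                     (∀ {y} → SameOrbit (w λ₀) a y → SameOrbit (w λ₀) a (b λ₀ y)) →
                                     numCycles (w λ₀) ≡ 1
  b-closed-orbit⇒numCycles-white≡1 a b-closed =
    Orbits.numCycles-transitive w-injective a
      (λ y → Reach-closed (SameOrbit (w λ₀) a) SameOrbit-step b-closed SameOrbit-refl (connected λ₀ a y))

Equivalent-sym : {μ ν : BPT n} → Equivalent μ ν → Equivalent ν μ
Equivalent-sym {μ = μ} {ν} (p , p-w , p-b) = flip p , conj⁻¹ {w μ} {w ν} p-w , conj⁻¹ {b μ} {b ν} p-b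
  where
  conj⁻¹ : ∀ {f g} → (∀ x → p ⟨$⟩ʳ f x ≡ g (p ⟨$⟩ʳ x)) → ∀ y → p ⟨$⟩ˡ g y ≡ f (p ⟨$⟩ˡ y)
  conj⁻¹ {f} {g} conj y = ⟨$⟩ʳ-injective p (begin
    p ⟨$⟩ʳ (p ⟨$⟩ˡ g y)   ≡⟨ inverseʳ p ⟩
    g y                   ≡⟨ cong g (inverseʳ p) ⟨
    g (p ⟨$⟩ʳ (p ⟨$⟩ˡ y)) ≡⟨ conj (p ⟨$⟩ˡ y) ⟨
    p ⟨$⟩ʳ f (p ⟨$⟩ˡ y)   ∎)
    where open ≡-Reasoning

MovedPointsInOneOrbit : (Fin n → Fin n) → Set
MovedPointsInOneOrbit f = ∀ {x y} → f x ≢ x → f y ≢ y → SameOrbit f x y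

MovedPointsInOneOrbit-conj : {f g p : Fin n → Fin n} → Injective _≡_ _≡_ p →
                             (∀ x → p (f x) ≡ g (p x)) →
                             MovedPointsInOneOrbit g → MovedPointsInOneOrbit f
MovedPointsInOneOrbit-conj {f = f} {g} {p} p-injective conj one {x} {y} fx≢x fy≢y =
  let k , gᵏpx≡py = one (moved fx≢x) (moved fy≢y)
  in k , p-injective (trans (iter-conj conj k x) gᵏpx≡py)
  where
  moved : ∀ {x} → f x ≢ x → g (p x) ≢ p x
  moved {x} fx≢x gpx≡px = fx≢x (p-injective (trans (conj x) gpx≡px))

Equivalent⇒MovedPointsInOneOrbit : {μ ν : BPT n} → Equivalent μ ν →
                                   MovedPointsInOneOrbit (b ν) → MovedPointsInOneOrbit (b μ)
Equivalent⇒MovedPointsInOneOrbit (p , _ , p-b) = MovedPointsInOneOrbit-conj (⟨$⟩ʳ-injective p) p-b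

-- Trees with two white vertices

transposition⇒λ : (λ₀ : BPT n) → numCycles (w λ₀) ≡ 2 →
                  {e x₀ : Fin n} → IsTransposition (b λ₀) e x₀ →
                  Σ ℕ λ r → Σ ℕ λ s → 1 ≤ r × 1 ≤ s × IsLambda r s λ₀
transposition⇒λ λ₀ two {e} {x₀} τ =
  cycleLen W e , cycleLen W (B e) , W.1≤cycleLen e , W.1≤cycleLen (B e) ,
  two , e , separated , refl , refl , cycleLen-transposition (b-injective λ₀) τ , others
  where
  W = w λ₀
  B = b λ₀
  module W = Orbits (w-injective λ₀)
  open IsTransposition τ
  separated : sameOrbit W e (B e) ≡ false
  separated = Equivalence.to T-not-≡ (¬T⇒T-not λ t → contradiction (trans (sym (one-white t)) two) λ ())
    where
    one-white : T (sameOrbit W e (B e)) → numCycles W ≡ 1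
    one-white t = b-closed-orbit⇒numCycles-white≡1 λ₀ e b-closed
      where
      b-closed : ∀ {y} → SameOrbit W e y → SameOrbit W e (B y)
      b-closed {y} e∼y with y ≟ e | y ≟ x₀
      ... | yes refl | _        = sameOrbit-sound t
      ... | no _     | yes refl = subst (SameOrbit W e) (sym maps-b) SameOrbit-refl
      ... | no y≢e   | no y≢x₀  = subst (SameOrbit W e) (sym (fixes y y≢e y≢x₀)) e∼y
  others : ∀ x → sameOrbit B e x ≡ false → cycleLen B x ≡ 1
  others x e≁x = cycleLen-off-transposition (b-injective λ₀) τ (subst T e≁x)

twoWhiteVertices⇒λ : (λ₀ : BPT n) → numCycles (w λ₀) ≡ 2 →
                     Σ ℕ λ r → Σ ℕ λ s → 1 ≤ r × 1 ≤ s × IsLambda r s λ₀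
twoWhiteVertices⇒λ λ₀ two =
  let one-nonLeader = ℕₚ.suc-injective (trans (sym (numCycles-white λ₀)) two)
      _ , _ , τ     = oneNonLeader⇒transposition (b-injective λ₀) one-nonLeader
  in transposition⇒λ λ₀ two τ

-- Cyclic permutations

module _ {m : ℕ} where

  next : Fin (suc m) → Fin (suc m)
  next i with m ℕ.≟ toℕ i
  ... | yes _   = zero
  ... | no  m≢i = suc (Fin.lower₁ i m≢i)

  prev : Fin (suc m) → Fin (suc m)
  prev zero    = Fin.fromℕ m
  prev (suc i) = Fin.inject₁ i

  next-inject₁ : (i : Fin m) → next (Fin.inject₁ i) ≡ suc i
  next-inject₁ i with m ℕ.≟ toℕ (Fin.inject₁ i)
  ... | yes m≡i = contradiction m≡i (Finₚ.toℕ-inject₁-≢ i)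
  ... | no  m≢i = cong suc (Finₚ.lower₁-inject₁′ i m≢i)

  next-prev : ∀ i → next (prev i) ≡ i
  next-prev zero with m ℕ.≟ toℕ (Fin.fromℕ m)
  ... | yes _   = refl
  ... | no  m≢m = contradiction (sym (Finₚ.toℕ-fromℕ m)) m≢m
  next-prev (suc i) = next-inject₁ i

  prev-next : ∀ i → prev (next i) ≡ i
  prev-next i with m ℕ.≟ toℕ i
  ... | yes m≡i = Finₚ.toℕ-injective (trans (Finₚ.toℕ-fromℕ m) m≡i)
  ... | no  m≢i = Finₚ.inject₁-lower₁ i m≢i

  rotation : Permutation′ (suc m)
  rotation = permutation next prev next-prev prev-next

module Extension {M : Fin m → Fin n} (M-injective : Injective _≡_ _≡_ M) where

  private
    act : (Fin m → Fin m) → Fin n → Fin n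
    act σ y with Finₚ.any? (λ i → M i ≟ y)
    ... | yes (i , _) = M (σ i)
    ... | no  _       = y

    act-image : ∀ σ i → act σ (M i) ≡ M (σ i)
    act-image σ i with Finₚ.any? (λ j → M j ≟ M i)
    ... | yes (j , Mj≡Mi) = cong (M ∘ σ) (M-injective Mj≡Mi)
    ... | no  ∄j          = contradiction (i , refl) ∄j

    act-outside : ∀ σ {y} → ¬ T (inImage M y) → act σ y ≡ y
    act-outside σ {y} y∉M with Finₚ.any? (λ i → M i ≟ y)
    ... | yes _ = contradiction _ y∉M
    ... | no  _ = refl

    act-inverse : ∀ {σ τ} → (∀ i → σ (τ i) ≡ i) → ∀ y → act σ (act τ y) ≡ y
    act-inverse {σ} {τ} στ≡id y with Finₚ.any? (λ i → M i ≟ y)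
    ... | yes (i , refl) = trans (act-image σ (τ i)) (cong M (στ≡id i))
    ... | no  ∄i         = act-outside σ (∄i ∘ toWitness)

  opaque
    extend : Permutation′ m → Permutation′ n
    extend σ = permutation (act (σ ⟨$⟩ʳ_)) (act (σ ⟨$⟩ˡ_))
                           (act-inverse (λ _ → inverseʳ σ)) (act-inverse (λ _ → inverseˡ σ))

    extend-image : ∀ σ i → extend σ ⟨$⟩ʳ M i ≡ M (σ ⟨$⟩ʳ i)
    extend-image σ = act-image (σ ⟨$⟩ʳ_)

    extend-outside : ∀ σ y → ¬ T (inImage M y) → extend σ ⟨$⟩ʳ y ≡ y
    extend-outside σ y = act-outside (σ ⟨$⟩ʳ_) {y}

  extend-moved : ∀ σ y → extend σ ⟨$⟩ʳ y ≢ y → T (inImage M y)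
  extend-moved σ y moved with T? (inImage M y)
  ... | yes y∈M = y∈M
  ... | no  y∉M = contradiction (extend-outside σ y y∉M) moved

module CycleOrbit {h : Fin n → Fin n} (h-injective : Injective _≡_ _≡_ h)
                  {M : Fin (suc m) → Fin n} (M-injective : Injective _≡_ _≡_ M)
                  (h-M : ∀ i → h (M i) ≡ M (next i)) where

  open Orbits h-injective

  SameOrbit-M : ∀ i → SameOrbit h (M zero) (M i)
  SameOrbit-M = Finᵢ.<-weakInduction (λ i → SameOrbit h (M zero) (M i)) SameOrbit-refl step
    where
    step : ∀ i → SameOrbit h (M zero) (M (Fin.inject₁ i)) → SameOrbit h (M zero) (M (suc i))
    step i o = subst (SameOrbit h (M zero)) (trans (h-M _) (cong M (next-inject₁ i))) (SameOrbit-step o)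

  SameOrbit-M⇒inImage : {y : Fin n} → SameOrbit h (M zero) y → T (inImage M y)
  SameOrbit-M⇒inImage = SameOrbit-closed (T ∘ inImage M) closed (inImage⁺ M zero)
    where
    closed : {y : Fin n} → T (inImage M y) → T (inImage M (h y))
    closed {y} y∈M with inImage⁻ M y y∈M
    ... | i , refl = subst (T ∘ inImage M) (sym (h-M i)) (inImage⁺ M (next i))

  sameOrbit-M≡inImage : ∀ y → sameOrbit h (M zero) y ≡ inImage M y
  sameOrbit-M≡inImage y = T-ext (SameOrbit-M⇒inImage ∘ sameOrbit-sound) in-orbit
    where
    in-orbit : T (inImage M y) → T (sameOrbit h (M zero) y)
    in-orbit y∈M with inImage⁻ M y y∈M
    ... | i , refl = sameOrbit-complete (SameOrbit-M i)

  count-nonLeaders-image : count (λ x → not (isLeader h x) ∧ inImage M x) ≡ m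
  count-nonLeaders-image = ℕₚ.suc-injective (begin
    suc (count (λ x → not (isLeader h x) ∧ inImage M x))
      ≡⟨ cong suc (count-cong (λ x → cong (not (isLeader h x) ∧_) (sameOrbit-M≡inImage x))) ⟨
    suc (count (λ x → not (isLeader h x) ∧ sameOrbit h (M zero) x))
      ≡⟨ cycleLen≡suc-nonLeaders (M zero) ⟨
    cycleLen h (M zero)
      ≡⟨ cycleLen≡count h (M zero) ⟩
    count (sameOrbit h (M zero))
      ≡⟨ count-cong sameOrbit-M≡inImage ⟩
    count (inImage M)
      ≡⟨ count-inImage M M-injective ⟩
    suc m
      ∎)
    where open ≡-Reasoning

-- Trees with at least three white vertices

module ThreeWhiteVertices (λ₀ : BPT n) (c : ℕ) (three : numCycles (w λ₀) ≡ 3 + c)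
                          (many-black : numCycles (b λ₀) ≢ 1) where

  private
    W = w λ₀
    module W = Orbits (w-injective λ₀)

  opaque
    z : Fin n
    z = proj₁ (white-nonLeader λ₀ many-black)

    z-nonLeader : ¬ T (isLeader W z)
    z-nonLeader = proj₂ (white-nonLeader λ₀ many-black)

    leaders : Enumeration (isLeader W) (3 + c)
    leaders = subst (Enumeration (isLeader W)) (trans (sym (numCycles≡count W)) three) (enumerate (isLeader W))

  open Enumeration leaders
    renaming (elem to M; injective to M-injective; sound to M-leader; complete to M-complete)

  leader-index : (x : Fin n) → ∃ λ i → SameOrbit W x (M i)
  leader-index x =
    let ℓ , x∼ℓ , Lℓ = W.leaderOf x
        i , Mi≡ℓ     = M-complete ℓ Lℓ
    in i , subst (SameOrbit W x) (sym Mi≡ℓ) x∼ℓ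

  M≢z : ∀ i → M i ≢ z
  M≢z i Mi≡z = z-nonLeader (subst (T ∘ isLeader W) Mi≡z (M-leader i))

  withBlack : (h : Permutation′ n) → count (not ∘ isLeader (h ⟨$⟩ʳ_)) ≡ 2 + c →
              (root : Fin n) → (∀ x → Reach W (h ⟨$⟩ʳ_) x root) → BPT n
  withBlack h count-nonLeaders root to-root = record
    { white     = white λ₀
    ; black     = h
    ; connected = connected-via (w-injective λ₀) (⟨$⟩ʳ-injective h) root to-root
    ; euler     = Equivalence.from (euler⇔ W (h ⟨$⟩ʳ_)) (trans three (cong suc (sym count-nonLeaders)))
    }

  -- One black vertex joined to the leading edge M i of every white vertex.

  module Hub = Extension M-injective

  hub : Permutation′ n
  hub = Hub.extend rotation

  module HubOrbit = CycleOrbit (⟨$⟩ʳ-injective hub) M-injective (Hub.extend-image rotation)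

  oneHub : BPT n
  oneHub = withBlack hub count-nonLeaders (M zero) to-hub
    where
    count-nonLeaders : count (not ∘ isLeader (hub ⟨$⟩ʳ_)) ≡ 2 + c
    count-nonLeaders =
      trans (Orbits.nonLeaders-within (⟨$⟩ʳ-injective hub) (inImage M) (Hub.extend-outside rotation))
            HubOrbit.count-nonLeaders-image
    to-hub : ∀ x → Reach W (hub ⟨$⟩ʳ_) x (M zero)
    to-hub x =
      let i , x∼Mi = leader-index x
      in Reach-trans (SameOrbit⇒Reachᶠ x∼Mi)
                     (SameOrbit⇒Reachᵍ (Orbits.SameOrbit-sym (⟨$⟩ʳ-injective hub) (HubOrbit.SameOrbit-M i)))

  MovedPointsInOneOrbit-hub : MovedPointsInOneOrbit (hub ⟨$⟩ʳ_)
  MovedPointsInOneOrbit-hub {x} {y} x-moved y-moved =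
    via-indices (inImage⁻ M x (Hub.extend-moved rotation x x-moved))
                (inImage⁻ M y (Hub.extend-moved rotation y y-moved))
    where
    via-indices : {x y : Fin n} → (∃ λ i → M i ≡ x) → (∃ λ j → M j ≡ y) → SameOrbit (hub ⟨$⟩ʳ_) x y
    via-indices (i , refl) (j , refl) =
      SameOrbit-trans (Orbits.SameOrbit-sym (⟨$⟩ʳ-injective hub) (HubOrbit.SameOrbit-M i)) (HubOrbit.SameOrbit-M j)

  -- z lies on the white vertex of M j. One black vertex is joined to M i for every i ≢ j′,
  -- a second one to M j′ and z.

  j : Fin (3 + c)
  j = proj₁ (leader-index z)

  j′ : Fin (3 + c)
  j′ = Fin.punchIn j zero

  M₁ : Fin (2 + c) → Fin n
  M₁ = M ∘ Fin.punchIn j′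

  M₂ : Fin 2 → Fin n
  M₂ = z ∷ M j′ ∷ []

  M₁-injective : Injective _≡_ _≡_ M₁
  M₁-injective = Finₚ.punchIn-injective j′ _ _ ∘ M-injective

  M₂-injective : Injective _≡_ _≡_ M₂
  M₂-injective {zero}     {zero}     _ = refl
  M₂-injective {zero}     {suc zero} e = contradiction (sym e) (M≢z j′)
  M₂-injective {suc zero} {zero}     e = contradiction e (M≢z j′)
  M₂-injective {suc zero} {suc zero} _ = refl

  images-disjoint : ∀ y → ¬ (T (inImage M₁ y) × T (inImage M₂ y))
  images-disjoint y (y∈M₁ , y∈M₂) = via-indices (inImage⁻ M₁ y y∈M₁) (inImage⁻ M₂ y y∈M₂)
    where
    via-indices : (∃ λ i → M₁ i ≡ y) → (∃ λ k → M₂ k ≡ y) → ⊥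
    via-indices (i , refl) (zero     , z≡M₁i)   = M≢z _ (sym z≡M₁i)
    via-indices (i , refl) (suc zero , Mj′≡M₁i) = Finₚ.punchInᵢ≢i j′ i (M-injective (sym Mj′≡M₁i))

  module Hub₁ = Extension M₁-injective
  module Hub₂ = Extension M₂-injective

  hubs : Permutation′ n
  hubs = Hub₂.extend rotation ∘ₚ Hub₁.extend rotation

  hubs-M₁ : ∀ i → hubs ⟨$⟩ʳ M₁ i ≡ M₁ (next i)
  hubs-M₁ i =
    trans (cong (Hub₁.extend rotation ⟨$⟩ʳ_)
                (Hub₂.extend-outside rotation (M₁ i) (λ i∈M₂ → images-disjoint (M₁ i) (inImage⁺ M₁ i , i∈M₂))))
          (Hub₁.extend-image rotation i)

  hubs-M₂ : ∀ i → hubs ⟨$⟩ʳ M₂ i ≡ M₂ (next i)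
  hubs-M₂ i =
    trans (cong (Hub₁.extend rotation ⟨$⟩ʳ_) (Hub₂.extend-image rotation i))
          (Hub₁.extend-outside rotation (M₂ (next i))
                               (λ i∈M₁ → images-disjoint (M₂ (next i)) (i∈M₁ , inImage⁺ M₂ (next i))))

  hubs-outside : ∀ y → ¬ T (inImage M₁ y ∨ inImage M₂ y) → hubs ⟨$⟩ʳ y ≡ y
  hubs-outside y y∉ =
    trans (cong (Hub₁.extend rotation ⟨$⟩ʳ_)
                (Hub₂.extend-outside rotation y (y∉ ∘ Equivalence.from ∨-T ∘ inj₂)))
          (Hub₁.extend-outside rotation y (y∉ ∘ Equivalence.from ∨-T ∘ inj₁))
    where
    ∨-T = T-∨ {inImage M₁ y} {inImage M₂ y}

  module HubsOrbit = Orbits (⟨$⟩ʳ-injective hubs)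
  module Orbit₁ = CycleOrbit (⟨$⟩ʳ-injective hubs) M₁-injective hubs-M₁
  module Orbit₂ = CycleOrbit (⟨$⟩ʳ-injective hubs) M₂-injective hubs-M₂

  twoHubs : BPT n
  twoHubs = withBlack hubs count-nonLeaders (M₁ zero) to-hub
    where
    open ≡-Reasoning
    NL : Fin n → Bool
    NL x = not (isLeader (hubs ⟨$⟩ʳ_) x)
    disjoint : ∀ x → ¬ (T (NL x ∧ inImage M₁ x) × T (NL x ∧ inImage M₂ x))
    disjoint x (t₁ , t₂) =
      images-disjoint x (proj₂ (Equivalence.to (T-∧ {NL x}) t₁) , proj₂ (Equivalence.to (T-∧ {NL x}) t₂))
    count-nonLeaders : count NL ≡ 2 + c
    count-nonLeaders = begin
      count NL
        ≡⟨ HubsOrbit.nonLeaders-within _ hubs-outside ⟩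
      count (λ x → NL x ∧ (inImage M₁ x ∨ inImage M₂ x))
        ≡⟨ count-cong (λ x → ∧-distribˡ-∨ (NL x) _ _) ⟩
      count (λ x → (NL x ∧ inImage M₁ x) ∨ (NL x ∧ inImage M₂ x))
        ≡⟨ count-∨ {P = λ x → NL x ∧ inImage M₁ x} {Q = λ x → NL x ∧ inImage M₂ x} disjoint ⟩
      count (λ x → NL x ∧ inImage M₁ x) + count (λ x → NL x ∧ inImage M₂ x)
        ≡⟨ cong₂ _+_ Orbit₁.count-nonLeaders-image Orbit₂.count-nonLeaders-image ⟩
      suc c + 1
        ≡⟨ ℕₚ.+-comm (suc c) 1 ⟩
      2 + c
        ∎
    to-hub₁ : ∀ i → j′ ≢ i → Reach W (hubs ⟨$⟩ʳ_) (M i) (M₁ zero)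
    to-hub₁ i j′≢i =
      subst (λ x → Reach W (hubs ⟨$⟩ʳ_) x (M₁ zero)) (cong M (Finₚ.punchIn-punchOut j′≢i))
            (SameOrbit⇒Reachᵍ (HubsOrbit.SameOrbit-sym (Orbit₁.SameOrbit-M (Fin.punchOut j′≢i))))
    Mj′-to-z : Reach W (hubs ⟨$⟩ʳ_) (M j′) z
    Mj′-to-z = subst (Reach W (hubs ⟨$⟩ʳ_) (M j′))
                     (trans (hubs-M₂ (suc zero)) (cong M₂ (next-prev zero))) (viag here)
    to-hub : ∀ x → Reach W (hubs ⟨$⟩ʳ_) x (M₁ zero)
    to-hub x with leader-index x
    ... | i , x∼Mi with j′ ≟ i
    ...   | no  j′≢i = Reach-trans (SameOrbit⇒Reachᶠ x∼Mi) (to-hub₁ i j′≢i)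
    ...   | yes refl = Reach-trans (SameOrbit⇒Reachᶠ x∼Mi)
                         (Reach-trans Mj′-to-z (Reach-trans (SameOrbit⇒Reachᶠ (proj₂ (leader-index z)))
                                                            (to-hub₁ j (Finₚ.punchInᵢ≢i j zero))))

  ¬MovedPointsInOneOrbit-hubs : ¬ MovedPointsInOneOrbit (hubs ⟨$⟩ʳ_)
  ¬MovedPointsInOneOrbit-hubs one =
    images-disjoint z (Orbit₁.SameOrbit-M⇒inImage (one {M₁ zero} {z} M₁₀-moved z-moved) , inImage⁺ M₂ zero)
    where
    -- The only use of k ≥ 3: M₁ has 2 + c ≥ 2 entries, so M₁ zero is moved.
    M₁₀-moved : hubs ⟨$⟩ʳ M₁ zero ≢ M₁ zero
    M₁₀-moved e =
      contradiction (M₁-injective (trans (sym (trans (hubs-M₁ zero) (cong M₁ (next-inject₁ zero)))) e)) λ ()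
    z-moved : hubs ⟨$⟩ʳ z ≢ z
    z-moved e = M≢z j′ (trans (sym (trans (hubs-M₂ zero) (cong M₂ (next-inject₁ zero)))) e)

  ¬DeterminedByType : ¬ DeterminedByType λ₀
  ¬DeterminedByType det = ¬MovedPointsInOneOrbit-hubs
    (Equivalent⇒MovedPointsInOneOrbit {μ = twoHubs} {ν = λ₀} (det twoHubs ↭-refl)
      (Equivalent⇒MovedPointsInOneOrbit {μ = λ₀} {ν = oneHub}
        (Equivalent-sym {μ = oneHub} {ν = λ₀} (det oneHub ↭-refl))
        MovedPointsInOneOrbit-hub))

proposition3p1 : (n : ℕ) (λ₀ : BPT n) → DeterminedByType λ₀ → StarBlackCenter λ₀ ⊎ StarWhiteCenter λ₀ ⊎ Σ ℕ (λ r → Σ ℕ (λ s → 1 ≤ r × 1 ≤ s × IsLambda r s λ₀))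
proposition3p1 n λ₀ det with numCycles (b λ₀) ℕ.≟ 1
... | yes one-black = inj₁ one-black
... | no  many-black with count (not ∘ isLeader (b λ₀)) in nonLeaders
...   | zero        = inj₂ (inj₁ (trans (numCycles-white λ₀) (cong suc nonLeaders)))
...   | suc zero    = inj₂ (inj₂ (twoWhiteVertices⇒λ λ₀ (trans (numCycles-white λ₀) (cong suc nonLeaders))))
...   | suc (suc c) = contradiction det
  (ThreeWhiteVertices.¬DeterminedByType λ₀ c (trans (numCycles-white λ₀) (cong suc nonLeaders)) many-black)
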